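{- Let $q\in(0,1)$ and let $G=(V,E)$ be a graph with $n=|V|$ vertices. If $(A,B)$ is a $q$-internal partition of $G$ with $|A|=qn$, then $(A,B)$ is a $(1-q)$-external partition of the complement $\bar G$ (with $|A|=qn$, $|B|=(1-q)n$).
   Context: Graphs are finite and simple; $\bar G$ is the complement graph of $G$. For $S\subseteq V$ and $v\in V$, $d_S(v)$ is the number of neighbors of $v$ in $S$ (in the graph under consideration) and $d_G(v)$ the degree of $v$ in $G$. A partition $(A,B)$ of $V$ (with $A,B$ nonempty) is $q$-internal in $G$ if $d_A(x)\ge q\,d_G(x)$ for all $x\in A$ and $d_B(x)\ge(1-q)\,d_G(x)$ for all $x\in B$. It is $q$-external in $G$ if $d_B(x)\ge q\,d_G(x)$ for all $x\in A$ and $d_A(x)\ge(1-q)\,d_G(x)$ for all $x\in B$. -}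

module Defs where

open import Data.Nat using (ℕ)
open import Data.Bool using (Bool; true; false; not; _∧_)
open import Data.Fin using (Fin; _≟_)
open import Data.Fin.Properties using ()
open import Data.Fin.Subset using (Subset; _∈_; _∩_; ∁; ∣_∣; Nonempty)
open import Data.Vec using (tabulate)
open import Data.Integer using (+_)
open import Data.Rational using (ℚ; _/_; _≤_; _*_; _-_; 1ℚ)
open import Data.Product using (_×_)
open import Relation.Nullary.Decidable using (⌊_⌋; yes; no)
open import Data.Empty using (⊥-elim)
open import Relation.Binary.PropositionalEquality using (_≡_; refl; cong₂; cong; trans)

record Graph (n : ℕ) : Set where
  field
    adj   : Fin n → Fin n → Bool
    sym   : ∀ u v → adj u v ≡ adj v u
    irref : ∀ v → adj v v ≡ false
open Graph public

private
  ≟-sym : ∀ {n} (u v : Fin n) → ⌊ u ≟ v ⌋ ≡ ⌊ v ≟ u ⌋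
  ≟-sym u v with u ≟ v | v ≟ u
  ... | yes _ | yes _ = refl
  ... | no _  | no _  = refl
  ... | yes refl | no ¬p = ⊥-elim (¬p refl)
  ... | no ¬p | yes refl = ⊥-elim (¬p refl)

  ≟-refl : ∀ {n} (v : Fin n) → ⌊ v ≟ v ⌋ ≡ true
  ≟-refl v with v ≟ v
  ... | yes _ = refl
  ... | no ¬p = ⊥-elim (¬p refl)

  ∧-false : ∀ b → b ∧ false ≡ false
  ∧-false true = refl
  ∧-false false = refl

complement : ∀ {n} → Graph n → Graph n
complement G = record
  { adj   = λ u v → not (adj G u v) ∧ not ⌊ u ≟ v ⌋
  ; sym   = λ u v → cong₂ (λ a b → not a ∧ not b) (sym G u v) (≟-sym u v)
  ; irref = λ v → trans
                    (cong (λ b → not (adj G v v) ∧ not b) (≟-refl v))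
                    (∧-false (not (adj G v v)))
  }

N : ∀ {n} → Graph n → Fin n → Subset n
N G v = tabulate (adj G v)

deg : ∀ {n} → Graph n → Fin n → ℕ
deg G v = ∣ N G v ∣

degIn : ∀ {n} → Graph n → Subset n → Fin n → ℕ
degIn G S v = ∣ S ∩ N G v ∣

ℕ→ℚ : ℕ → ℚ
ℕ→ℚ m = + m / 1

IsPartition : ∀ {n} → Subset n → Set
IsPartition A = Nonempty A × Nonempty (∁ A)

Internal : ∀ {n} → ℚ → Graph n → Subset n → Set
Internal q G A =
  IsPartition A ×
  (∀ x → x ∈ A → q * ℕ→ℚ (deg G x) ≤ ℕ→ℚ (degIn G A x)) ×
  (∀ x → x ∈ ∁ A → (1ℚ - q) * ℕ→ℚ (deg G x) ≤ ℕ→ℚ (degIn G (∁ A) x))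

External : ∀ {n} → ℚ → Graph n → Subset n → Set
External q G A =
  IsPartition A ×
  (∀ x → x ∈ A → q * ℕ→ℚ (deg G x) ≤ ℕ→ℚ (degIn G (∁ A) x)) ×
  (∀ x → x ∈ ∁ A → (1ℚ - q) * ℕ→ℚ (deg G x) ≤ ℕ→ℚ (degIn G A x))

-- For x ∈ A the complement graph gives d̄(x) ≤ n - d(x) and, since x ∉ B,
-- d̄_B(x) = |B| - d_B(x) = (1-q)n - d_B(x); q-internality d_A(x) ≥ q d(x) means
-- d_B(x) ≤ (1-q) d(x), hence (1-q) d̄(x) ≤ (1-q)n - (1-q) d(x) ≤ d̄_B(x).
-- The case x ∈ B is the same argument with the roles of A, B and of q, 1-q swapped.
module Submission where

open import Defs
open import Data.Bool using (true; false; not; _∧_)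
open import Data.Bool.Properties using (∧-identityʳ)
open import Data.Fin using (Fin; _≟_)
open import Data.Fin.Subset using (Subset; _∈_; _∉_; _∩_; ∁; ∣_∣; outside; inside)
open import Data.Fin.Subset.Properties
  using (∣p∣≤n; ∣∁p∣≡n∸∣p∣; ∣p∩q∣≤∣q∣; ∩-comm; x∈p⇒x∉∁p; x∈∁p⇒x∉p)
open import Data.Integer as ℤ using (+_)
import Data.Integer.Properties as ℤ
open import Data.Nat as ℕ using (ℕ)
import Data.Nat.Properties as ℕ
import Data.Nat.Coprimality as Coprime
open import Data.Product using (_×_; _,_)
open import Data.Rational using (ℚ; mkℚ; _+_; -_; _*_; _-_; _≤_; _<_; *≤*; 0ℚ; 1ℚ; nonNegative)
open import Data.Rational.Properties
  using (normalize-coprime; *-monoˡ-≤-nonNeg; +-monoˡ-≤; +-monoʳ-≤; <⇒≤; module ≤-Reasoning)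
open import Data.Rational.Solver using (module +-*-Solver)
open import Data.Vec using ([]; _∷_; lookup; tabulate)
open import Data.Vec.Properties using (lookup-zipWith; lookup-map; lookup∘tabulate; tabulate∘lookup; tabulate-cong; lookup⇒[]=)
open import Relation.Nullary using (contradiction)
open import Relation.Nullary.Decidable using (⌊_⌋; yes; no)
open import Relation.Binary.PropositionalEquality
  using (_≡_; refl; trans; cong; cong₂; subst; module ≡-Reasoning)
  renaming (sym to ≡-sym)

open +-*-Solver using (solve; _:=_; _:+_; _:-_; _:*_; con)

Subset-ext : ∀ {n} {p q : Subset n} → (∀ i → lookup p i ≡ lookup q i) → p ≡ q
Subset-ext {p = p} {q} p≗q = begin
  p                   ≡⟨ ≡-sym (tabulate∘lookup p) ⟩
  tabulate (lookup p) ≡⟨ tabulate-cong p≗q ⟩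
  tabulate (lookup q) ≡⟨ tabulate∘lookup q ⟩
  q                   ∎
  where open ≡-Reasoning

lookup-∩ : ∀ {n} (p q : Subset n) i → lookup (p ∩ q) i ≡ lookup p i ∧ lookup q i
lookup-∩ p q i = lookup-zipWith _∧_ i p q

lookup-∁ : ∀ {n} (p : Subset n) i → lookup (∁ p) i ≡ not (lookup p i)
lookup-∁ p i = lookup-map i not p

x∉p⇒lookup≡outside : ∀ {n} {x : Fin n} {p : Subset n} → x ∉ p → lookup p x ≡ outside
x∉p⇒lookup≡outside {x = x} {p} x∉p with lookup p x in eq
... | outside = refl
... | inside  = contradiction (lookup⇒[]= x p eq) x∉p

∣p∩q∣+∣∁p∩q∣≡∣q∣ : ∀ {n} (p q : Subset n) → ∣ p ∩ q ∣ ℕ.+ ∣ ∁ p ∩ q ∣ ≡ ∣ q ∣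
∣p∩q∣+∣∁p∩q∣≡∣q∣ []            []            = refl
∣p∩q∣+∣∁p∩q∣≡∣q∣ (inside  ∷ p) (inside  ∷ q) = cong ℕ.suc (∣p∩q∣+∣∁p∩q∣≡∣q∣ p q)
∣p∩q∣+∣∁p∩q∣≡∣q∣ (outside ∷ p) (inside  ∷ q) =
  trans (ℕ.+-suc ∣ p ∩ q ∣ ∣ ∁ p ∩ q ∣) (cong ℕ.suc (∣p∩q∣+∣∁p∩q∣≡∣q∣ p q))
∣p∩q∣+∣∁p∩q∣≡∣q∣ (inside  ∷ p) (outside ∷ q) = ∣p∩q∣+∣∁p∩q∣≡∣q∣ p q
∣p∩q∣+∣∁p∩q∣≡∣q∣ (outside ∷ p) (outside ∷ q) = ∣p∩q∣+∣∁p∩q∣≡∣q∣ p q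

∣p∣+∣∁p∣≡n : ∀ {n} (p : Subset n) → ∣ p ∣ ℕ.+ ∣ ∁ p ∣ ≡ n
∣p∣+∣∁p∣≡n p = trans (cong (∣ p ∣ ℕ.+_) (∣∁p∣≡n∸∣p∣ p)) (ℕ.m+[n∸m]≡n (∣p∣≤n p))

lookup-N : ∀ {n} (G : Graph n) x i → lookup (N G x) i ≡ adj G x i
lookup-N G x i = lookup∘tabulate (adj G x) i

lookup-∁N : ∀ {n} (G : Graph n) x i → lookup (∁ (N G x)) i ≡ not (adj G x i)
lookup-∁N G x i = trans (lookup-∁ (N G x) i) (cong not (lookup-N G x i))

N-complement⊆∁N : ∀ {n} (G : Graph n) x → N (complement G) x ≡ N (complement G) x ∩ ∁ (N G x)
N-complement⊆∁N G x = Subset-ext λ i → begin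
  lookup (N (complement G) x) i                       ≡⟨ lookup-N (complement G) x i ⟩
  not (adj G x i) ∧ not ⌊ x ≟ i ⌋                     ≡⟨ absorb (not (adj G x i)) _ ⟩
  (not (adj G x i) ∧ not ⌊ x ≟ i ⌋) ∧ not (adj G x i)  ≡⟨ cong₂ _∧_ (≡-sym (lookup-N (complement G) x i)) (≡-sym (lookup-∁N G x i)) ⟩
  lookup (N (complement G) x) i ∧ lookup (∁ (N G x)) i ≡⟨ ≡-sym (lookup-∩ (N (complement G) x) (∁ (N G x)) i) ⟩
  lookup (N (complement G) x ∩ ∁ (N G x)) i            ∎
  where
  open ≡-Reasoning
  absorb : ∀ a b → a ∧ b ≡ (a ∧ b) ∧ a
  absorb false b = refl
  absorb true  b = ≡-sym (∧-identityʳ b)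

deg-complement+deg≤n : ∀ {n} (G : Graph n) x → deg (complement G) x ℕ.+ deg G x ℕ.≤ n
deg-complement+deg≤n {n} G x = ℕ.m≤o∸n⇒m+n≤o _ (∣p∣≤n (N G x)) (begin
  ∣ N (complement G) x ∣                 ≡⟨ cong ∣_∣ (N-complement⊆∁N G x) ⟩
  ∣ N (complement G) x ∩ ∁ (N G x) ∣     ≤⟨ ∣p∩q∣≤∣q∣ (N (complement G) x) (∁ (N G x)) ⟩
  ∣ ∁ (N G x) ∣                         ≡⟨ ∣∁p∣≡n∸∣p∣ (N G x) ⟩
  n ℕ.∸ deg G x                         ∎)
  where open ℕ.≤-Reasoning

∩-N-complement : ∀ {n} (G : Graph n) {S : Subset n} {x} → x ∉ S → S ∩ N (complement G) x ≡ S ∩ ∁ (N G x)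
∩-N-complement G {S} {x} x∉S = Subset-ext λ i → begin
  lookup (S ∩ N (complement G) x) i                    ≡⟨ lookup-∩ S (N (complement G) x) i ⟩
  lookup S i ∧ lookup (N (complement G) x) i           ≡⟨ cong (lookup S i ∧_) (lookup-N (complement G) x i) ⟩
  lookup S i ∧ (not (adj G x i) ∧ not ⌊ x ≟ i ⌋)       ≡⟨ drop-diagonal i ⟩
  lookup S i ∧ not (adj G x i)                         ≡⟨ cong (lookup S i ∧_) (≡-sym (lookup-∁N G x i)) ⟩
  lookup S i ∧ lookup (∁ (N G x)) i                    ≡⟨ ≡-sym (lookup-∩ S (∁ (N G x)) i) ⟩
  lookup (S ∩ ∁ (N G x)) i                             ∎
  where
  open ≡-Reasoning
  drop-diagonal : ∀ i → lookup S i ∧ (not (adj G x i) ∧ not ⌊ x ≟ i ⌋) ≡ lookup S i ∧ not (adj G x i)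
  drop-diagonal i with x ≟ i
  ... | yes refl rewrite x∉p⇒lookup≡outside x∉S = refl
  ... | no _     = cong (lookup S i ∧_) (∧-identityʳ _)

degIn-complement+degIn : ∀ {n} (G : Graph n) {S : Subset n} {x} → x ∉ S →
                         degIn (complement G) S x ℕ.+ degIn G S x ≡ ∣ S ∣
degIn-complement+degIn G {S} {x} x∉S = begin
  ∣ S ∩ N (complement G) x ∣ ℕ.+ ∣ S ∩ N G x ∣   ≡⟨ cong₂ (λ p q → ∣ p ∣ ℕ.+ ∣ q ∣) (trans (∩-N-complement G x∉S) (∩-comm S _)) (∩-comm S _) ⟩
  ∣ ∁ (N G x) ∩ S ∣ ℕ.+ ∣ N G x ∩ S ∣           ≡⟨ ℕ.+-comm ∣ ∁ (N G x) ∩ S ∣ ∣ N G x ∩ S ∣ ⟩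
  ∣ N G x ∩ S ∣ ℕ.+ ∣ ∁ (N G x) ∩ S ∣           ≡⟨ ∣p∩q∣+∣∁p∩q∣≡∣q∣ (N G x) S ⟩
  ∣ S ∣                                       ∎
  where open ≡-Reasoning

ℕ→ℚ≡mkℚ : ∀ m → ℕ→ℚ m ≡ mkℚ (+ m) 0 (Coprime.sym (Coprime.1-coprimeTo m))
ℕ→ℚ≡mkℚ m = normalize-coprime (Coprime.sym (Coprime.1-coprimeTo m))

ℕ→ℚ-homo-+ : ∀ m k → ℕ→ℚ (m ℕ.+ k) ≡ ℕ→ℚ m + ℕ→ℚ k
ℕ→ℚ-homo-+ m k
  rewrite ℕ→ℚ≡mkℚ m | ℕ→ℚ≡mkℚ k | ℕ.*-identityʳ m | ℕ.*-identityʳ k | ℤ.+◃n≡+n m | ℤ.+◃n≡+n k = refl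

ℕ→ℚ-mono-≤ : ∀ {m k} → m ℕ.≤ k → ℕ→ℚ m ≤ ℕ→ℚ k
ℕ→ℚ-mono-≤ {m} {k} m≤k rewrite ℕ→ℚ≡mkℚ m | ℕ→ℚ≡mkℚ k = *≤* (ℤ.*-monoʳ-≤-nonNeg (+ 1) (ℤ.+≤+ m≤k))

ℕ→ℚ-+-≡ : ∀ m k {l} → m ℕ.+ k ≡ l → ℕ→ℚ m + ℕ→ℚ k ≡ ℕ→ℚ l
ℕ→ℚ-+-≡ m k m+k≡l = trans (≡-sym (ℕ→ℚ-homo-+ m k)) (cong ℕ→ℚ m+k≡l)

ℕ→ℚ-+-≤ : ∀ m k {l} → m ℕ.+ k ℕ.≤ l → ℕ→ℚ m + ℕ→ℚ k ≤ ℕ→ℚ l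
ℕ→ℚ-+-≤ m k {l} m+k≤l = subst (_≤ ℕ→ℚ l) (ℕ→ℚ-homo-+ m k) (ℕ→ℚ-mono-≤ m+k≤l)

+-≤⇒≤-∸ : ∀ {p q r} → p + q ≤ r → p ≤ r - q
+-≤⇒≤-∸ {p} {q} {r} p+q≤r = begin
  p           ≡⟨ solve 2 (λ p q → p := (p :+ q) :- q) refl p q ⟩
  (p + q) - q ≤⟨ +-monoˡ-≤ (- q) p+q≤r ⟩
  r - q       ∎
  where open ≤-Reasoning

0≤1-q : ∀ {q} → q < 1ℚ → 0ℚ ≤ 1ℚ - q
0≤1-q {q} q<1 = begin
  0ℚ     ≡⟨ solve 1 (λ q → con 0ℚ := q :- q) refl q ⟩
  q - q  ≤⟨ +-monoˡ-≤ (- q) (<⇒≤ q<1) ⟩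
  1ℚ - q ∎
  where open ≤-Reasoning

1-[1-q]≡q : ∀ q → 1ℚ - (1ℚ - q) ≡ q
1-[1-q]≡q = solve 1 (λ q → con 1ℚ :- (con 1ℚ :- q) := q) refl

[1-q]n≡n-qn : ∀ q {n a b} → a + b ≡ n → a ≡ q * n → b ≡ (1ℚ - q) * n
[1-q]n≡n-qn q {n} {a} {b} a+b≡n refl = begin
  b                      ≡⟨ solve 2 (λ x b → b := (x :+ b) :- x) refl (q * n) b ⟩
  (q * n + b) - q * n    ≡⟨ cong (_- q * n) a+b≡n ⟩
  n - q * n              ≡⟨ solve 2 (λ q n → n :- q :* n := (con 1ℚ :- q) :* n) refl q n ⟩
  (1ℚ - q) * n           ∎
  where open ≡-Reasoning

complement-degree-bound : ∀ p {dIn dOut d e f n} → 0ℚ ≤ p →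
  dIn + dOut ≡ d → e + d ≤ n → f + dOut ≡ p * n → (1ℚ - p) * d ≤ dIn → p * e ≤ f
complement-degree-bound p {dIn} {dOut} {e = e} {f} {n} 0≤p refl e+d≤n f+dOut≡pn [1-p]d≤dIn = begin
  p * e                                      ≤⟨ *-monoˡ-≤-nonNeg p {{nonNegative 0≤p}} (+-≤⇒≤-∸ e+d≤n) ⟩
  p * (n - (dIn + dOut))                     ≡⟨ solve 4 (λ p n a b → p :* (n :- (a :+ b)) := p :* n :- (a :+ b) :+ (con 1ℚ :- p) :* (a :+ b)) refl p n dIn dOut ⟩
  p * n - (dIn + dOut) + (1ℚ - p) * (dIn + dOut) ≤⟨ +-monoʳ-≤ (p * n - (dIn + dOut)) [1-p]d≤dIn ⟩
  p * n - (dIn + dOut) + dIn                 ≡⟨ cong (λ t → t - (dIn + dOut) + dIn) (≡-sym f+dOut≡pn) ⟩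
  (f + dOut) - (dIn + dOut) + dIn            ≡⟨ solve 3 (λ f a b → (f :+ b) :- (a :+ b) :+ a := f) refl f dIn dOut ⟩
  f                                          ∎
  where open ≤-Reasoning

complement-external-at : ∀ {n} p (G : Graph n) (S T : Subset n) {x} → 0ℚ ≤ p → x ∉ S →
  degIn G T x ℕ.+ degIn G S x ≡ deg G x → ℕ→ℚ ∣ S ∣ ≡ p * ℕ→ℚ n →
  (1ℚ - p) * ℕ→ℚ (deg G x) ≤ ℕ→ℚ (degIn G T x) →
  p * ℕ→ℚ (deg (complement G) x) ≤ ℕ→ℚ (degIn (complement G) S x)
complement-external-at p G S T {x} 0≤p x∉S degree-split ∣S∣≡pn =
  complement-degree-bound p 0≤p
    (ℕ→ℚ-+-≡ (degIn G T x) (degIn G S x) degree-split)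
    (ℕ→ℚ-+-≤ (deg (complement G) x) (deg G x) (deg-complement+deg≤n G x))
    (trans (ℕ→ℚ-+-≡ (degIn (complement G) S x) (degIn G S x) (degIn-complement+degIn G x∉S)) ∣S∣≡pn)

proposition2 : (q : ℚ) → 0ℚ < q → q < 1ℚ → (n : ℕ) → (G : Graph n) → (A : Subset n) →
    Internal q G A → ℕ→ℚ ∣ A ∣ ≡ q * ℕ→ℚ n →
    External (1ℚ - q) (complement G) A × ℕ→ℚ ∣ A ∣ ≡ q * ℕ→ℚ n × ℕ→ℚ ∣ ∁ A ∣ ≡ (1ℚ - q) * ℕ→ℚ n
proposition2 q 0<q q<1 n G A (partition , internalA , internalB) ∣A∣≡qn =
  (partition , externalA , externalB) , ∣A∣≡qn , ∣B∣≡[1-q]n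
  where
  ∣B∣≡[1-q]n : ℕ→ℚ ∣ ∁ A ∣ ≡ (1ℚ - q) * ℕ→ℚ n
  ∣B∣≡[1-q]n = [1-q]n≡n-qn q (ℕ→ℚ-+-≡ ∣ A ∣ ∣ ∁ A ∣ (∣p∣+∣∁p∣≡n A)) ∣A∣≡qn

  externalA : ∀ x → x ∈ A → (1ℚ - q) * ℕ→ℚ (deg (complement G) x) ≤ ℕ→ℚ (degIn (complement G) (∁ A) x)
  externalA x x∈A = complement-external-at (1ℚ - q) G (∁ A) A (0≤1-q q<1) (x∈p⇒x∉∁p x∈A)
    (∣p∩q∣+∣∁p∩q∣≡∣q∣ A (N G x)) ∣B∣≡[1-q]n
    (subst (λ r → r * ℕ→ℚ (deg G x) ≤ _) (≡-sym (1-[1-q]≡q q)) (internalA x x∈A))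

  externalB : ∀ x → x ∈ ∁ A → (1ℚ - (1ℚ - q)) * ℕ→ℚ (deg (complement G) x) ≤ ℕ→ℚ (degIn (complement G) A x)
  externalB x x∈B = subst (λ r → r * ℕ→ℚ (deg (complement G) x) ≤ _) (≡-sym (1-[1-q]≡q q))
    (complement-external-at q G A (∁ A) (<⇒≤ 0<q) (x∈∁p⇒x∉p x∈B)
      (trans (ℕ.+-comm (degIn G (∁ A) x) (degIn G A x)) (∣p∩q∣+∣∁p∩q∣≡∣q∣ A (N G x))) ∣A∣≡qn
      (internalB x x∈B))
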